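{- Let $k\ge 2$, let $\Sigma$ be an alphabet of $k$ symbols with symbol codes $0,\dots,k-1$, let $\beta=k+1$, and let $\ulcorner\cdot\urcorner$ be the block-partition encoding. For $m\ge1$ let $L(m)=\max\{\operatorname{digits}(\ulcorner s\urcorner): s\in\Sigma^m\}$, where $\operatorname{digits}(n)$ is the number of decimal digits of $n$. Then $L(m)=\Theta(m)$ as $m\to\infty$ (for fixed $k$).
   Context: $F_n$ is the Fibonacci sequence ($F_0=0$, $F_1=1$, $F_{n+2}=F_{n+1}+F_n$). The block-partition encoding is $\ulcorner\varepsilon\urcorner=0$ and, for a nonempty string $s=s_1\cdots s_m$ with symbol codes $c_1,\dots,c_m\in\{0,\dots,k-1\}$, $\ulcorner s\urcorner=\sum_{i=0}^{m-1}F_{2+i\beta+c_{i+1}}$. -}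

module Defs where

open import Data.Nat using (ℕ; zero; suc; _+_; _*_; _<ᵇ_; _⊔_)
open import Data.Fin using (Fin; toℕ)
open import Data.Vec using (Vec; []; _∷_)
open import Data.List using (List; []; _∷_; map; concatMap; foldr; allFin)
open import Data.Bool using (if_then_else_)

F : ℕ → ℕ
F zero = 0
F (suc zero) = 1
F (suc (suc n)) = F (suc n) + F n

encFrom : ∀ {k m} → ℕ → ℕ → Vec (Fin k) m → ℕ
encFrom β i [] = 0
encFrom β i (c ∷ s) = F (2 + i * β + toℕ c) + encFrom β (suc i) s

code : ∀ {k m} → Vec (Fin k) m → ℕ
code {k} s = encFrom (suc k) 0 s

-- number of decimal digits (digits 0 = 1); digitsAux uses fuel ≥ n
digitsAux : ℕ → ℕ → ℕ
digitsAux zero n = 1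
digitsAux (suc fuel) n =
  if n <ᵇ 10 then 1 else suc (digitsAux fuel (n Data.Nat./ 10))

digits : ℕ → ℕ
digits n = digitsAux n n

allStrings : ∀ k m → List (Vec (Fin k) m)
allStrings k zero = [] ∷ []
allStrings k (suc m) =
  concatMap (λ c → map (c ∷_) (allStrings k m)) (allFin k)

L : ℕ → ℕ → ℕ
L k m = foldr _⊔_ 0 (map (λ s → digits (code s)) (allStrings k m))

-- Every code ⌜s⌝ with |s| = m ≥ 1 contains the term F(2 + (m-1)β) ≥ 2^(m-1) of its last
-- block. Conversely F n ≤ 2^n, and since symbol codes are below β, the term of block i
-- plus 2^(2+iβ) is at most 2^(2+(i+1)β); these bounds telescope to ⌜s⌝ < 2^(2+mβ).
-- So ⌜s⌝ has between ⌊(m-1)/4⌋ + 1 and 2 + mβ decimal digits.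
module Submission where

open import Defs
open import Data.Nat using (ℕ; _*_; _≤_; _≥_)
open import Data.Product using (Σ; _×_)

open import Data.Nat
  using (zero; suc; _+_; _^_; _<_; _<ᵇ_; _/_; _%_; z≤n; s≤s; _≤′_; ≤′-refl; ≤′-step; NonZero; >-nonZero)
open import Data.Nat.Properties
open import Data.Nat.DivMod using (m≡m%n+[m/n]*n; m%n<n; m/n*n≤m; m*n/n≡m; /-monoˡ-≤; m/n<m; m<n*o⇒m/o<n)
open import Data.Fin as Fin using (Fin; toℕ)
open import Data.Fin.Properties using (toℕ<n)
open import Data.Vec using (Vec; []; _∷_; replicate)
open import Data.List using (map)
open import Data.List.Properties using (foldr-preservesᵇ; foldr-preservesᵒ)
open import Data.List.Membership.Propositional using (_∈_; lose)
open import Data.List.Membership.Propositional.Properties using (∈-allFin; ∈-map⁺; ∈-concatMap⁺)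
open import Data.List.Relation.Unary.Any using (here)
open import Data.List.Relation.Unary.All using (universal)
open import Data.List.Relation.Unary.All.Properties using (map⁺)
open import Data.Bool using (true; false)
open import Data.Sum using ([_,_]; inj₂)
open import Data.Product using (_,_)
open import Relation.Nullary using (contradiction)
open import Relation.Nullary.Reflects using (ofʸ; ofⁿ)
open import Algebra.Properties.CommutativeSemigroup +-commutativeSemigroup using (xy∙z≈y∙xz)
open import Relation.Binary.PropositionalEquality using (refl; sym; cong; subst)

∈-allStrings : ∀ k m (s : Vec (Fin k) m) → s ∈ allStrings k m
∈-allStrings k zero    []      = here refl
∈-allStrings k (suc m) (c ∷ s) =
  ∈-concatMap⁺ (λ c → map (c ∷_) (allStrings k m))
    (lose (∈-allFin c) (∈-map⁺ (c ∷_) (∈-allStrings k m s)))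

L≤ : ∀ k m {x} → (∀ (s : Vec (Fin k) m) → digits (code s) ≤ x) → L k m ≤ x
L≤ k m {x} bound = foldr-preservesᵇ {P = _≤ x} ⊔-lub z≤n (map⁺ (universal bound (allStrings k m)))

≤L : ∀ {k m} (s : Vec (Fin k) m) → digits (code s) ≤ L k m
≤L {k} {m} s =
  foldr-preservesᵒ {P = digits (code s) ≤_} (λ x y → [ m≤n⇒m≤n⊔o y , m≤n⇒m≤o⊔n x ]) 0 _
  (inj₂ (lose (∈-map⁺ (λ s → digits (code s)) (∈-allStrings k m s)) ≤-refl))

1≤digitsAux : ∀ fuel n → 1 ≤ digitsAux fuel n
1≤digitsAux zero       n = s≤s z≤n
1≤digitsAux (suc fuel) n with n <ᵇ 10
... | true  = s≤s z≤n
... | false = s≤s z≤n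

digitsAux≤ : ∀ fuel n d → n < 10 ^ suc d → digitsAux fuel n ≤ suc d
digitsAux≤ zero       n d       _ = s≤s z≤n
digitsAux≤ (suc fuel) n zero    n<10 with n <ᵇ 10 | <ᵇ-reflects-< n 10
... | true  | _        = s≤s z≤n
... | false | ofⁿ n≮10 = contradiction n<10 n≮10
digitsAux≤ (suc fuel) n (suc d) n<10^[2+d] with n <ᵇ 10
... | true  = s≤s z≤n
... | false = s≤s (digitsAux≤ fuel (n / 10) d
                    (m<n*o⇒m/o<n (subst (n <_) (*-comm 10 (10 ^ suc d)) n<10^[2+d])))

digits≤ : ∀ n d → n < 10 ^ suc d → digits n ≤ suc d
digits≤ n = digitsAux≤ n n

-- The fuel bound n ≤ fuel guarantees that digitsAux does not stop before n < 10.
≤digitsAux : ∀ fuel n d → n ≤ fuel → 10 ^ d ≤ n → suc d ≤ digitsAux fuel n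
≤digitsAux fuel       n zero    _      _       = 1≤digitsAux fuel n
≤digitsAux zero       n (suc d) n≤0    10^d≤n  =
  contradiction (≤-trans 10^d≤n n≤0) (<⇒≱ (m^n>0 10 (suc d)))
≤digitsAux (suc fuel) n (suc d) n≤fuel 10^d≤n with n <ᵇ 10 | <ᵇ-reflects-< n 10
... | true  | ofʸ n<10 = contradiction (≤-trans (*-monoʳ-≤ 10 (m^n>0 10 d)) 10^d≤n) (<⇒≱ n<10)
... | false | _        = s≤s (≤digitsAux fuel (n / 10) d n/10≤fuel 10^d≤n/10)
  where
  instance
    n≢0 : NonZero n
    n≢0 = >-nonZero (≤-trans (m^n>0 10 (suc d)) 10^d≤n)
  n/10≤fuel : n / 10 ≤ fuel
  n/10≤fuel = ≤-pred (≤-trans (m/n<m n 10 (s≤s (s≤s z≤n))) n≤fuel)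
  10^d≤n/10 : 10 ^ d ≤ n / 10
  10^d≤n/10 = subst (_≤ n / 10) (m*n/n≡m (10 ^ d) 10)
                (/-monoˡ-≤ 10 (subst (_≤ n) (*-comm 10 (10 ^ d)) 10^d≤n))

≤digits : ∀ n d → 10 ^ d ≤ n → suc d ≤ digits n
≤digits n d = ≤digitsAux n n d ≤-refl

F[n]≤F[1+n] : ∀ n → F n ≤ F (suc n)
F[n]≤F[1+n] zero    = z≤n
F[n]≤F[1+n] (suc n) = m≤m+n (F (suc n)) (F n)

F-mono-≤ : ∀ {m n} → m ≤ n → F m ≤ F n
F-mono-≤ m≤n = go (≤⇒≤′ m≤n)
  where
  go : ∀ {m n} → m ≤′ n → F m ≤ F n
  go ≤′-refl                    = ≤-refl
  go {n = suc n} (≤′-step m≤′n) = ≤-trans (go m≤′n) (F[n]≤F[1+n] n)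

F≤2^ : ∀ n → F n ≤ 2 ^ n
F≤2^ zero          = z≤n
F≤2^ (suc zero)    = s≤s z≤n
F≤2^ (suc (suc n)) = begin
  F (suc n) + F n         ≤⟨ +-mono-≤ (F≤2^ (suc n)) (≤-trans (F≤2^ n) (^-monoʳ-≤ 2 (n≤1+n n))) ⟩
  2 ^ suc n + 2 ^ suc n   ≡⟨ cong (2 ^ suc n +_) (sym (+-identityʳ (2 ^ suc n))) ⟩
  2 ^ suc (suc n)         ∎
  where open ≤-Reasoning

2^n≤F[2+2*n] : ∀ n → 2 ^ n ≤ F (2 + 2 * n)
2^n≤F[2+2*n] zero    = s≤s z≤n
2^n≤F[2+2*n] (suc n) = begin
  2 ^ n + (2 ^ n + 0)  ≡⟨ cong (2 ^ n +_) (+-identityʳ (2 ^ n)) ⟩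
  2 ^ n + 2 ^ n        ≤⟨ +-mono-≤ (≤-trans ih (F[n]≤F[1+n] (2 + 2 * n))) ih ⟩
  F (4 + 2 * n)        ≡⟨ cong (λ x → F (2 + x)) (sym (*-suc 2 n)) ⟩
  F (2 + 2 * suc n)    ∎
  where
  open ≤-Reasoning
  ih : 2 ^ n ≤ F (2 + 2 * n)
  ih = 2^n≤F[2+2*n] n

F[2+[i+n]β]≤encFrom : ∀ {k n} β i (s : Vec (Fin k) (suc n)) → F (2 + (i + n) * β) ≤ encFrom β i s
F[2+[i+n]β]≤encFrom {n = zero} β i (c ∷ []) = begin
  F (2 + (i + 0) * β)        ≡⟨ cong (λ j → F (2 + j * β)) (+-identityʳ i) ⟩
  F (2 + i * β)              ≤⟨ F-mono-≤ (m≤m+n (2 + i * β) (toℕ c)) ⟩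
  F (2 + i * β + toℕ c)      ≤⟨ m≤m+n _ 0 ⟩
  F (2 + i * β + toℕ c) + 0  ∎
  where open ≤-Reasoning
F[2+[i+n]β]≤encFrom {n = suc n} β i (c ∷ s) = begin
  F (2 + (i + suc n) * β)    ≡⟨ cong (λ j → F (2 + j * β)) (+-suc i n) ⟩
  F (2 + (suc i + n) * β)    ≤⟨ F[2+[i+n]β]≤encFrom β (suc i) s ⟩
  encFrom β (suc i) s        ≤⟨ m≤n+m _ _ ⟩
  encFrom β i (c ∷ s)        ∎
  where open ≤-Reasoning

2^[n+c]+2^n≤2^[n+β] : ∀ n {c β} → c < β → 2 ^ (n + c) + 2 ^ n ≤ 2 ^ (n + β)
2^[n+c]+2^n≤2^[n+β] n {c} {β} c<β = begin
  2 ^ (n + c) + 2 ^ n        ≤⟨ +-monoʳ-≤ (2 ^ (n + c)) (^-monoʳ-≤ 2 (m≤m+n n c)) ⟩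
  2 ^ (n + c) + 2 ^ (n + c)  ≡⟨ cong (2 ^ (n + c) +_) (sym (+-identityʳ (2 ^ (n + c)))) ⟩
  2 ^ suc (n + c)            ≡⟨ cong (2 ^_) (sym (+-suc n c)) ⟩
  2 ^ (n + suc c)            ≤⟨ ^-monoʳ-≤ 2 (+-monoʳ-≤ n c<β) ⟩
  2 ^ (n + β)                ∎
  where open ≤-Reasoning

encFrom+2^≤2^ : ∀ {k m} β i (s : Vec (Fin k) m) → k ≤ β →
                encFrom β i s + 2 ^ (2 + i * β) ≤ 2 ^ (2 + (i + m) * β)
encFrom+2^≤2^ β i []      _   = ≤-reflexive (cong (λ j → 2 ^ (2 + j * β)) (sym (+-identityʳ i)))
encFrom+2^≤2^ {m = suc m} β i (c ∷ s) k≤β = begin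
  F (Y + toℕ c) + E + 2 ^ Y      ≡⟨ xy∙z≈y∙xz (F (Y + toℕ c)) E (2 ^ Y) ⟩
  E + (F (Y + toℕ c) + 2 ^ Y)    ≤⟨ +-monoʳ-≤ E (+-monoˡ-≤ (2 ^ Y) (F≤2^ (Y + toℕ c))) ⟩
  E + (2 ^ (Y + toℕ c) + 2 ^ Y)  ≤⟨ +-monoʳ-≤ E (2^[n+c]+2^n≤2^[n+β] Y (≤-trans (toℕ<n c) k≤β)) ⟩
  E + 2 ^ (Y + β)                ≡⟨ cong (λ e → E + 2 ^ (2 + e)) (+-comm (i * β) β) ⟩
  E + 2 ^ (2 + suc i * β)        ≤⟨ encFrom+2^≤2^ β (suc i) s k≤β ⟩
  2 ^ (2 + (suc i + m) * β)      ≡⟨ cong (λ j → 2 ^ (2 + j * β)) (sym (+-suc i m)) ⟩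
  2 ^ (2 + (i + suc m) * β)      ∎
  where
  open ≤-Reasoning
  Y = 2 + i * β
  E = encFrom β (suc i) s

code<2^ : ∀ {k m} (s : Vec (Fin k) m) → code s < 2 ^ (2 + m * suc k)
code<2^ {k} s = <-≤-trans (m<m+n (code s) (m^n>0 2 2)) (encFrom+2^≤2^ (suc k) 0 s (n≤1+n k))

L≤[3+k]*m : ∀ k m → 1 ≤ m → L k m ≤ (3 + k) * m
L≤[3+k]*m k m 1≤m = L≤ k m λ s → begin
  digits (code s)  ≤⟨ digits≤ (code s) (suc (m * suc k)) (code<10^ s) ⟩
  2 + m * suc k    ≤⟨ +-mono-≤ 1≤m (+-mono-≤ 1≤m (≤-reflexive (*-comm m (suc k)))) ⟩
  (3 + k) * m      ∎
  where
  open ≤-Reasoning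
  code<10^ : (s : Vec (Fin k) m) → code s < 10 ^ (2 + m * suc k)
  code<10^ s = <-≤-trans (code<2^ s) (^-monoˡ-≤ (2 + m * suc k) (s≤s (s≤s z≤n)))

10^[n/4]≤2^n : ∀ n → 10 ^ (n / 4) ≤ 2 ^ n
10^[n/4]≤2^n n = begin
  10 ^ (n / 4)       ≤⟨ ^-monoˡ-≤ (n / 4) (+-monoʳ-≤ 10 (z≤n {6})) ⟩
  (2 ^ 4) ^ (n / 4)  ≡⟨ ^-*-assoc 2 4 (n / 4) ⟩
  2 ^ (4 * (n / 4))  ≤⟨ ^-monoʳ-≤ 2 (≤-trans (≤-reflexive (*-comm 4 (n / 4))) (m/n*n≤m n 4)) ⟩
  2 ^ n              ∎
  where open ≤-Reasoning

1+n≤4*[1+n/4] : ∀ n → suc n ≤ 4 * suc (n / 4)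
1+n≤4*[1+n/4] n = begin
  suc n                      ≡⟨ cong suc (m≡m%n+[m/n]*n n 4) ⟩
  suc (n % 4 + n / 4 * 4)    ≤⟨ +-monoˡ-≤ (n / 4 * 4) (m%n<n n 4) ⟩
  suc (n / 4) * 4            ≡⟨ *-comm (suc (n / 4)) 4 ⟩
  4 * suc (n / 4)            ∎
  where open ≤-Reasoning

-- A nonempty alphabet gives β ≥ 2, so the last block starts at index ≥ 2 + 2n.
1+n≤4*digits[code] : ∀ {k n} (s : Vec (Fin (suc k)) (suc n)) → suc n ≤ 4 * digits (code s)
1+n≤4*digits[code] {k} {n} s =
  ≤-trans (1+n≤4*[1+n/4] n) (*-monoʳ-≤ 4 (≤digits (code s) (n / 4) 10^[n/4]≤code))
  where
  open ≤-Reasoning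
  2*n≤n*β : 2 * n ≤ n * (2 + k)
  2*n≤n*β = ≤-trans (*-monoˡ-≤ n (m≤m+n 2 k)) (≤-reflexive (*-comm (2 + k) n))
  10^[n/4]≤code : 10 ^ (n / 4) ≤ code s
  10^[n/4]≤code = begin
    10 ^ (n / 4)             ≤⟨ 10^[n/4]≤2^n n ⟩
    2 ^ n                    ≤⟨ 2^n≤F[2+2*n] n ⟩
    F (2 + 2 * n)            ≤⟨ F-mono-≤ (+-monoʳ-≤ 2 2*n≤n*β) ⟩
    F (2 + n * (2 + k))      ≤⟨ F[2+[i+n]β]≤encFrom (2 + k) 0 s ⟩
    code s                   ∎

1+n≤4*L : ∀ k n → suc n ≤ 4 * L (suc k) (suc n)
1+n≤4*L k n = ≤-trans (1+n≤4*digits[code] s) (*-monoʳ-≤ 4 (≤L s))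
  where
  s : Vec (Fin (suc k)) (suc n)
  s = replicate (suc n) Fin.zero

theorem5p1 : (k : ℕ) → k ≥ 2 →
    Σ ℕ λ a → Σ ℕ λ b → Σ ℕ λ c → Σ ℕ λ M →
      (a ≥ 1) × (b ≥ 1) × (c ≥ 1) ×
      ((m : ℕ) → m ≥ 1 → m ≥ M → (a * m ≤ b * L k m) × (L k m ≤ c * m))
theorem5p1 k@(suc k′) _ = 1 , 4 , 3 + k , 0 , s≤s z≤n , s≤s z≤n , s≤s z≤n , Θ
  where
  Θ : (m : ℕ) → m ≥ 1 → m ≥ 0 → (1 * m ≤ 4 * L k m) × (L k m ≤ (3 + k) * m)
  Θ m@(suc n) 1≤m _ = ≤-trans (≤-reflexive (*-identityˡ m)) (1+n≤4*L k′ n) , L≤[3+k]*m k m 1≤m
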